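{- Let $D$ and $L$ be distributive lattices, with $D$ finite and $L$ having a least element $0$. Then a lattice homomorphism $f\colon D\to L$ has a consonance kernel if and only if the range of $f$ is consonant in $L$.
   Context: $\mathrm{J}(D)$ denotes the set of (nonzero) join-irreducible elements of $D$ and $p_*$ the unique lower cover of $p\in\mathrm{J}(D)$. A consonance kernel for $f$ is a family $(e_p\mid p\in\mathrm{J}(D))$ of elements of $L$ with $f(p)=f(p_*)\vee e_p$ for all $p\in\mathrm{J}(D)$ and $e_p\wedge e_q=0$ whenever $p,q\in\mathrm{J}(D)$ are incomparable. Two elements $a,b$ of a $0$-lattice $L$ are consonant if there exist $u,v\in L$ with $a\le u\vee b$, $b\le a\vee v$ and $u\wedge v=0$; a subset of $L$ is consonant if every pair of its elements is consonant. -}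

module Defs where

open import Level using (Level; _⊔_)
open import Data.Nat using (ℕ)
open import Data.Fin using (Fin)
open import Data.Product using (Σ; ∃; _×_)
open import Data.Sum using (_⊎_)
open import Relation.Nullary using (¬_)
open import Relation.Binary.PropositionalEquality using (_≡_)
open import Algebra.Lattice.Bundles using (DistributiveLattice)
open import Algebra.Lattice.Morphism.Structures using (module LatticeMorphisms)

module _ {c ℓ : Level} (D : DistributiveLattice c ℓ) where
  open DistributiveLattice D

  _≤_ : Carrier → Carrier → Set ℓ
  x ≤ y = (x ∧ y) ≈ x

  IsFinite : Set (c ⊔ ℓ)
  IsFinite = Σ ℕ λ n → Σ (Fin n → Carrier) λ enum →
    (∀ i j → enum i ≈ enum j → i ≡ j) × (∀ x → ∃ λ i → enum i ≈ x)

  IsJoinIrreducible : Carrier → Set (c ⊔ ℓ)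
  IsJoinIrreducible p =
    (¬ (∀ x → p ≤ x)) × (∀ a b → p ≈ (a ∨ b) → (p ≈ a) ⊎ (p ≈ b))

  IsLowerCover : Carrier → Carrier → Set (c ⊔ ℓ)
  IsLowerCover q p = (q ≤ p) × (¬ (q ≈ p)) ×
    (∀ z → q ≤ z → z ≤ p → (z ≈ q) ⊎ (z ≈ p))

  Incomparable : Carrier → Carrier → Set ℓ
  Incomparable p q = (¬ (p ≤ q)) × (¬ (q ≤ p))

-- lattice homomorphism (preserves ≈, ∧, ∨; not required to preserve bounds)
IsLatticeHom : {c₁ ℓ₁ c₂ ℓ₂ : Level} (D : DistributiveLattice c₁ ℓ₁) (L : DistributiveLattice c₂ ℓ₂) →
  (DistributiveLattice.Carrier D → DistributiveLattice.Carrier L) → Set (c₁ ⊔ ℓ₁ ⊔ ℓ₂)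
IsLatticeHom D L f = LatticeMorphisms.IsLatticeHomomorphism
  (DistributiveLattice.rawLattice D) (DistributiveLattice.rawLattice L) f

module _ {c₂ ℓ₂ : Level} (L : DistributiveLattice c₂ ℓ₂) (0L : DistributiveLattice.Carrier L) where
  open DistributiveLattice L

  Consonant : Carrier → Carrier → Set (c₂ ⊔ ℓ₂)
  Consonant a b = Σ Carrier λ u → Σ Carrier λ v →
    _≤_ L a (u ∨ b) × _≤_ L b (a ∨ v) × ((u ∧ v) ≈ 0L)

  module _ {c₁ ℓ₁ : Level} (D : DistributiveLattice c₁ ℓ₁)
           (f : DistributiveLattice.Carrier D → Carrier) where
    private module D = DistributiveLattice D

    IsConsonanceKernel : ((p : D.Carrier) → IsJoinIrreducible D p → Carrier) → Set (c₁ ⊔ ℓ₁ ⊔ ℓ₂)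
    IsConsonanceKernel e =
      (∀ p (jp : IsJoinIrreducible D p) → ∀ q → IsLowerCover D q p → f p ≈ (f q ∨ e p jp))
      × (∀ p (jp : IsJoinIrreducible D p) q (jq : IsJoinIrreducible D q) →
           Incomparable D p q → (e p jp ∧ e q jq) ≈ 0L)

    HasConsonanceKernel : Set (c₁ ⊔ ℓ₁ ⊔ c₂ ⊔ ℓ₂)
    HasConsonanceKernel = Σ ((p : D.Carrier) → IsJoinIrreducible D p → Carrier) IsConsonanceKernel

    RangeConsonant : Set (c₁ ⊔ c₂ ⊔ ℓ₂)
    RangeConsonant = ∀ x y → Consonant (f x) (f y)

-- (⇐) Orienting each consonant pair f xᵢ, f xⱼ by index gives δ i j with f xᵢ ≤ δ i j ∨ f xⱼ and
-- δ i j ∧ δ j i = 0.  Put e_p = f p ∧ ⋀ {δ p j | p ≰ xⱼ}: since xⱼ ∧ p ≤ p_* whenever p ≰ xⱼ, each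
-- factor absorbs f p into f p_* ∨ δ p j, and for incomparable p, q the meet e_p ∧ e_q lies below
-- δ p q ∧ δ q p = 0.
-- (⇒) Take u x y = ⋁ {e_p | p ∈ J(D), p ≤ x, p ≰ y}.  The indices of u x y and u y x are pairwise
-- incomparable, so u x y ∧ u y x = 0, and f z ≤ f y ∨ u x y for every z ≤ x by well-founded
-- induction: in a finite lattice z is the bottom, a join of two strictly smaller elements, or
-- join-irreducible with f z = f z_* ∨ e_z.

module Submission where

open import Defs
open import Level using (Level; _⊔_)
open import Data.Nat.Base using (ℕ; zero; suc)
open import Data.Fin.Base using (Fin; zero; suc)
open import Data.Fin.Properties using (all?; any?; ¬∀⟶∃¬; ≤-antisym; ≤-total)
  renaming (_≟_ to _≟ᶠ_; _≤?_ to _≤ᶠ?_)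
open import Data.Fin.Induction using (po-wellFounded)
open import Data.Vec.Functional using (foldr)
open import Data.Product using (Σ; ∃; _×_; _,_; proj₁; proj₂)
open import Data.Sum using (_⊎_; inj₁; inj₂; [_,_])
import Data.Sum as Sum
open import Data.Empty using (⊥-elim)
open import Function.Base using (_∘_)
open import Function.Bundles using (_⇔_; mk⇔)
open import Relation.Nullary using (¬_; yes; no)
open import Relation.Nullary.Decidable using (map′; _×-dec_)
open import Relation.Binary.Core using (Rel; _⇒_)
open import Relation.Binary.Definitions using (Reflexive; Transitive; Antisymmetric; Decidable)
open import Relation.Binary.Structures using (IsPartialOrder)
open import Relation.Binary.Bundles using (Poset)
open import Relation.Binary.PropositionalEquality using (_≡_; _≢_; cong)
open import Induction.WellFounded using (WellFounded; WfRec; module All; module Subrelation)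
import Relation.Binary.Construct.On as On
import Relation.Binary.Construct.NonStrictToStrict as NonStrictToStrict
import Relation.Binary.Reasoning.PartialOrder as PartialOrderReasoning
open import Algebra.Lattice.Bundles using (DistributiveLattice)
open import Algebra.Lattice.Morphism.Structures using (module LatticeMorphisms)

module LatticeOrder {c ℓ : Level} (D : DistributiveLattice c ℓ) where
  open DistributiveLattice D
  open import Algebra.Lattice.Properties.Lattice lattice using (∧-idem)

  infix 4 _⊑_

  _⊑_ : Rel Carrier ℓ
  _⊑_ = _≤_ D

  ⊑-reflexive : _≈_ ⇒ _⊑_
  ⊑-reflexive {x} x≈y = trans (∧-congˡ (sym x≈y)) (∧-idem x)

  ⊑-refl : Reflexive _⊑_
  ⊑-refl = ⊑-reflexive refl

  ⊑-trans : Transitive _⊑_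
  ⊑-trans {x} {y} {z} x⊑y y⊑z = begin
    x ∧ z        ≈⟨ ∧-congʳ x⊑y ⟨
    (x ∧ y) ∧ z  ≈⟨ ∧-assoc x y z ⟩
    x ∧ (y ∧ z)  ≈⟨ ∧-congˡ y⊑z ⟩
    x ∧ y        ≈⟨ x⊑y ⟩
    x            ∎
    where open import Relation.Binary.Reasoning.Setoid setoid

  ⊑-antisym : Antisymmetric _≈_ _⊑_
  ⊑-antisym {x} {y} x⊑y y⊑x = trans (sym x⊑y) (trans (∧-comm x y) y⊑x)

  ⊑-respˡ-≈ : ∀ {x x′ y} → x ≈ x′ → x ⊑ y → x′ ⊑ y
  ⊑-respˡ-≈ x≈x′ = ⊑-trans (⊑-reflexive (sym x≈x′))

  ⊑-respʳ-≈ : ∀ {x y y′} → y ≈ y′ → x ⊑ y → x ⊑ y′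
  ⊑-respʳ-≈ y≈y′ x⊑y = ⊑-trans x⊑y (⊑-reflexive y≈y′)

  ⊑-isPartialOrder : IsPartialOrder _≈_ _⊑_
  ⊑-isPartialOrder = record
    { isPreorder = record
      { isEquivalence = isEquivalence ; reflexive = ⊑-reflexive ; trans = ⊑-trans }
    ; antisym = ⊑-antisym
    }

  ⊑-poset : Poset c ℓ ℓ
  ⊑-poset = record { isPartialOrder = ⊑-isPartialOrder }

  module ⊑-Reasoning = PartialOrderReasoning ⊑-poset

  x∧y⊑x : ∀ x y → x ∧ y ⊑ x
  x∧y⊑x x y = trans (∧-congʳ (∧-comm x y)) (trans (∧-assoc y x x) (trans (∧-congˡ (∧-idem x)) (∧-comm y x)))

  x∧y⊑y : ∀ x y → x ∧ y ⊑ y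
  x∧y⊑y x y = trans (∧-assoc x y y) (∧-congˡ (∧-idem y))

  ∧-greatest : ∀ {x y z} → x ⊑ y → x ⊑ z → x ⊑ y ∧ z
  ∧-greatest {x} {y} {z} x⊑y x⊑z = trans (sym (∧-assoc x y z)) (trans (∧-congʳ x⊑y) x⊑z)

  x⊑x∨y : ∀ x y → x ⊑ x ∨ y
  x⊑x∨y = ∧-absorbs-∨

  y⊑x∨y : ∀ x y → y ⊑ x ∨ y
  y⊑x∨y x y = ⊑-respʳ-≈ (∨-comm y x) (x⊑x∨y y x)

  ∨-least : ∀ {x y z} → x ⊑ z → y ⊑ z → x ∨ y ⊑ z
  ∨-least {x} {y} {z} x⊑z y⊑z = trans (∧-distribʳ-∨ z x y) (∨-cong x⊑z y⊑z)

  ∧-monotonic : ∀ {x x′ y y′} → x ⊑ x′ → y ⊑ y′ → x ∧ y ⊑ x′ ∧ y′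
  ∧-monotonic x⊑x′ y⊑y′ =
    ∧-greatest (⊑-trans (x∧y⊑x _ _) x⊑x′) (⊑-trans (x∧y⊑y _ _) y⊑y′)

  ∨-monotonic : ∀ {x x′ y y′} → x ⊑ x′ → y ⊑ y′ → x ∨ y ⊑ x′ ∨ y′
  ∨-monotonic x⊑x′ y⊑y′ =
    ∨-least (⊑-trans x⊑x′ (x⊑x∨y _ _)) (⊑-trans y⊑y′ (y⊑x∨y _ _))

  open NonStrictToStrict _≈_ _⊑_ public using () renaming (_<_ to _⊏_)

  ⊏-respˡ-≈ : ∀ {x x′ y} → x ≈ x′ → x ⊏ y → x′ ⊏ y
  ⊏-respˡ-≈ = NonStrictToStrict.<-respˡ-≈ _≈_ _⊑_ trans ⊑-respˡ-≈

  ⊏-respʳ-≈ : ∀ {x y y′} → y ≈ y′ → x ⊏ y → x ⊏ y′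
  ⊏-respʳ-≈ = NonStrictToStrict.<-respʳ-≈ _≈_ _⊑_ sym trans ⊑-respʳ-≈

  ⊏⇒⊑lowerCover : ∀ {p q x} → IsJoinIrreducible D p → IsLowerCover D q p → x ⊏ p → x ⊑ q
  ⊏⇒⊑lowerCover {p} {q} {x} (_ , split) (q⊑p , q≉p , between) (x⊑p , x≉p)
    with between (x ∨ q) (y⊑x∨y x q) (∨-least x⊑p q⊑p)
  ... | inj₁ x∨q≈q = ⊑-respʳ-≈ x∨q≈q (x⊑x∨y x q)
  ... | inj₂ x∨q≈p = ⊥-elim ([ x≉p ∘ sym , q≉p ∘ sym ] (split x q (sym x∨q≈p)))

  ⋁ ⋀ : ∀ {n} → Carrier → (Fin n → Carrier) → Carrier
  ⋁ b g = foldr _∨_ b g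
  ⋀ b g = foldr _∧_ b g

  ⋁-upper : ∀ {n} b (g : Fin n → Carrier) j → g j ⊑ ⋁ b g
  ⋁-upper b g zero    = x⊑x∨y _ _
  ⋁-upper b g (suc j) = ⊑-trans (⋁-upper b (g ∘ suc) j) (y⊑x∨y _ _)

  ⋁-least : ∀ {n b z} {g : Fin n → Carrier} → b ⊑ z → (∀ j → g j ⊑ z) → ⋁ b g ⊑ z
  ⋁-least {zero}  b⊑z g⊑z = b⊑z
  ⋁-least {suc n} b⊑z g⊑z = ∨-least (g⊑z zero) (⋁-least b⊑z (g⊑z ∘ suc))

  ∧-⋁-least : ∀ {n w b z} {g : Fin n → Carrier} →
              w ∧ b ⊑ z → (∀ j → w ∧ g j ⊑ z) → w ∧ ⋁ b g ⊑ z
  ∧-⋁-least {zero}          wb⊑z wg⊑z = wb⊑z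
  ∧-⋁-least {suc n} {w} {g = g} wb⊑z wg⊑z =
    ⊑-respˡ-≈ (sym (∧-distribˡ-∨ w (g zero) _))
      (∨-least (wg⊑z zero) (∧-⋁-least wb⊑z (wg⊑z ∘ suc)))

  joinIrreducible-⋁ : ∀ {n x b} {g : Fin n → Carrier} → IsJoinIrreducible D x →
                      x ≈ ⋁ b g → x ≈ b ⊎ ∃ λ j → x ≈ g j
  joinIrreducible-⋁ {zero} _ x≈b = inj₁ x≈b
  joinIrreducible-⋁ {suc n} jx x≈⋁ with proj₂ jx _ _ x≈⋁
  ... | inj₁ x≈g₀ = inj₂ (zero , x≈g₀)
  ... | inj₂ x≈⋁₁ = Sum.map₂ (λ (j , x≈gⱼ) → suc j , x≈gⱼ) (joinIrreducible-⋁ jx x≈⋁₁)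

  ⋀-lower : ∀ {n} b (g : Fin n → Carrier) j → ⋀ b g ⊑ g j
  ⋀-lower b g zero    = x∧y⊑x _ _
  ⋀-lower b g (suc j) = ⊑-trans (x∧y⊑y _ _) (⋀-lower b (g ∘ suc) j)

  ⋀-lower-base : ∀ {n} b (g : Fin n → Carrier) → ⋀ b g ⊑ b
  ⋀-lower-base {zero}  b g = ⊑-refl
  ⋀-lower-base {suc n} b g = ⊑-trans (x∧y⊑y _ _) (⋀-lower-base b (g ∘ suc))

  ∨-⋀-greatest : ∀ {n x c b} {g : Fin n → Carrier} →
                 x ⊑ c ∨ b → (∀ j → x ⊑ c ∨ g j) → x ⊑ c ∨ ⋀ b g
  ∨-⋀-greatest {zero}          x⊑cb x⊑cg = x⊑cb
  ∨-⋀-greatest {suc n} {c = c} {g = g} x⊑cb x⊑cg =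
    ⊑-respʳ-≈ (sym (∨-distribˡ-∧ c (g zero) _))
      (∧-greatest (x⊑cg zero) (∨-⋀-greatest x⊑cb (x⊑cg ∘ suc)))

module FiniteLattice {c ℓ : Level} (D : DistributiveLattice c ℓ) (finite : IsFinite D) where
  open DistributiveLattice D
  open LatticeOrder D

  size : ℕ
  size = proj₁ finite

  enum : Fin size → Carrier
  enum = proj₁ (proj₂ finite)

  index : Carrier → Fin size
  index x = proj₁ (proj₂ (proj₂ (proj₂ finite)) x)

  enum-index : ∀ x → enum (index x) ≈ x
  enum-index x = proj₂ (proj₂ (proj₂ (proj₂ finite)) x)

  index≡⇒≈ : ∀ {x y} → index x ≡ index y → x ≈ y
  index≡⇒≈ {x} {y} i≡j = trans (sym (enum-index x)) (trans (reflexive (cong enum i≡j)) (enum-index y))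

  infix 4 _≟_ _⊑?_ _⊏?_

  _≟_ : Decidable _≈_
  x ≟ y = map′ index≡⇒≈ index-injective (index x ≟ᶠ index y)
    where
    index-injective : x ≈ y → index x ≡ index y
    index-injective x≈y = proj₁ (proj₂ (proj₂ finite)) _ _
      (trans (enum-index x) (trans x≈y (sym (enum-index y))))

  _⊑?_ : Decidable _⊑_
  x ⊑? y = x ∧ y ≟ x

  _⊏?_ : Decidable _⊏_
  _⊏?_ = NonStrictToStrict.<-decidable _≈_ _⊑_ _≟_ _⊑?_

  ⊏-wellFounded : WellFounded _⊏_
  ⊏-wellFounded = Subrelation.wellFounded ⊏⇒⊏-index
    (On.wellFounded index (po-wellFounded (On.isPartialOrder enum ⊑-isPartialOrder)))
    where
    ⊏⇒⊏-index : ∀ {x y} → x ⊏ y → enum (index x) ⊏ enum (index y)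
    ⊏⇒⊏-index x⊏y = ⊏-respˡ-≈ (sym (enum-index _)) (⊏-respʳ-≈ (sym (enum-index _)) x⊏y)

  ⊑enum⇒⊑ : ∀ {x} → (∀ j → x ⊑ enum j) → ∀ z → x ⊑ z
  ⊑enum⇒⊑ x⊑enum z = ⊑-respʳ-≈ (enum-index z) (x⊑enum (index z))

  data Reducible (x : Carrier) : Set (c ⊔ ℓ) where
    bottom : (∀ z → x ⊑ z) → Reducible x
    join   : ∀ a b → a ⊏ x → b ⊏ x → x ≈ a ∨ b → Reducible x

  reducible⊎joinIrreducible : ∀ x → Reducible x ⊎ IsJoinIrreducible D x
  reducible⊎joinIrreducible x with all? (λ j → x ⊑? enum j)
  ... | yes x⊑enum = inj₁ (bottom (⊑enum⇒⊑ x⊑enum))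
  ... | no x⋢enum with any? (λ i → any? (λ k → enum i ⊏? x ×-dec enum k ⊏? x ×-dec x ≟ enum i ∨ enum k))
  ...   | yes (_ , _ , i⊏x , k⊏x , x≈i∨k) = inj₁ (join _ _ i⊏x k⊏x x≈i∨k)
  ...   | no noProperJoin = inj₂ ((λ x⊑all → x⋢enum (x⊑all ∘ enum)) , split)
    where
    split : ∀ a b → x ≈ a ∨ b → x ≈ a ⊎ x ≈ b
    split a b x≈a∨b with x ≟ a | x ≟ b
    ... | yes x≈a | _       = inj₁ x≈a
    ... | no _    | yes x≈b = inj₂ x≈b
    ... | no x≉a  | no x≉b  = ⊥-elim (noProperJoin (index a , index b ,
            ⊏-respˡ-≈ (sym (enum-index a)) (⊑-respʳ-≈ (sym x≈a∨b) (x⊑x∨y a b) , x≉a ∘ sym) ,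
            ⊏-respˡ-≈ (sym (enum-index b)) (⊑-respʳ-≈ (sym x≈a∨b) (y⊑x∨y a b) , x≉b ∘ sym) ,
            trans x≈a∨b (sym (∨-cong (enum-index a) (enum-index b)))))

  -- The lower cover is the join of everything strictly below x; join-irreducibility keeps it below x.
  lowerCover : ∀ {x} → IsJoinIrreducible D x → Σ Carrier λ q → IsLowerCover D q x
  lowerCover {x} jx@(x≉⊥ , _) = s , proj₁ s⊏x , proj₂ s⊏x , between
    where
    x⋢some : ∃ λ j → ¬ x ⊑ enum j
    x⋢some = ¬∀⟶∃¬ size _ (λ j → x ⊑? enum j) (x≉⊥ ∘ ⊑enum⇒⊑)

    b : Carrier
    b = x ∧ enum (proj₁ x⋢some)

    b⊏x : b ⊏ x
    b⊏x = x∧y⊑x x _ , λ b≈x → proj₂ x⋢some (⊑-respˡ-≈ b≈x (x∧y⊑y x _))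

    below : Fin size → Carrier
    below j with enum j ⊏? x
    ... | yes _ = enum j
    ... | no _  = b

    below⊏x : ∀ j → below j ⊏ x
    below⊏x j with enum j ⊏? x
    ... | yes j⊏x = j⊏x
    ... | no _    = b⊏x

    ⊏x⇒⊑below : ∀ j → enum j ⊏ x → enum j ⊑ below j
    ⊏x⇒⊑below j j⊏x with enum j ⊏? x
    ... | yes _   = ⊑-refl
    ... | no j⊏̸x = ⊥-elim (j⊏̸x j⊏x)

    s : Carrier
    s = ⋁ b below

    s⊏x : s ⊏ x
    s⊏x = ⋁-least (proj₁ b⊏x) (proj₁ ∘ below⊏x) ,
          λ s≈x → [ proj₂ b⊏x ∘ sym , (λ (j , x≈j) → proj₂ (below⊏x j) (sym x≈j)) ]
                    (joinIrreducible-⋁ jx (sym s≈x))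

    between : ∀ z → s ⊑ z → z ⊑ x → z ≈ s ⊎ z ≈ x
    between z s⊑z z⊑x with z ≟ x
    ... | yes z≈x = inj₂ z≈x
    ... | no z≉x  = inj₁ (⊑-antisym (⊑-respˡ-≈ (enum-index z) z⊑s) s⊑z)
      where
      z⊑s : enum (index z) ⊑ s
      z⊑s = ⊑-trans (⊏x⇒⊑below (index z) (⊏-respˡ-≈ (sym (enum-index z)) (z⊑x , z≉x)))
                    (⋁-upper b below (index z))

module ConsonantFamily {c ℓ : Level} (L : DistributiveLattice c ℓ) (0L : DistributiveLattice.Carrier L)
  {n : ℕ} (h : Fin n → DistributiveLattice.Carrier L) (consonant : ∀ i j → Consonant L 0L (h i) (h j)) where
  open DistributiveLattice L
  open LatticeOrder L

  private
    u v : Fin n → Fin n → Carrier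
    u i j = proj₁ (consonant i j)
    v i j = proj₁ (proj₂ (consonant i j))

    u-cover : ∀ i j → h i ⊑ u i j ∨ h j
    u-cover i j = proj₁ (proj₂ (proj₂ (consonant i j)))

    v-cover : ∀ i j → h j ⊑ h i ∨ v i j
    v-cover i j = proj₁ (proj₂ (proj₂ (proj₂ (consonant i j))))

    u∧v≈0 : ∀ i j → u i j ∧ v i j ≈ 0L
    u∧v≈0 i j = proj₂ (proj₂ (proj₂ (proj₂ (consonant i j))))

  -- Orienting each pair by index makes δ i j and δ j i the two halves u, v of one consonance
  -- witness, hence disjoint.
  δ : Fin n → Fin n → Carrier
  δ i j with i ≤ᶠ? j
  ... | yes _ = u i j
  ... | no _  = v j i

  δ-cover : ∀ i j → h i ⊑ δ i j ∨ h j
  δ-cover i j with i ≤ᶠ? j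
  ... | yes _ = u-cover i j
  ... | no _  = ⊑-respʳ-≈ (∨-comm _ _) (v-cover j i)

  δ-disjoint : ∀ {i j} → i ≢ j → δ i j ∧ δ j i ≈ 0L
  δ-disjoint {i} {j} i≢j with i ≤ᶠ? j | j ≤ᶠ? i
  ... | yes i≤j | yes j≤i = ⊥-elim (i≢j (≤-antisym i≤j j≤i))
  ... | yes _   | no _    = u∧v≈0 i j
  ... | no _    | yes _   = trans (∧-comm _ _) (u∧v≈0 j i)
  ... | no i≰j  | no j≰i  = ⊥-elim ([ i≰j , j≰i ] (≤-total i j))

module _ {c₁ ℓ₁ c₂ ℓ₂ : Level}
  (D : DistributiveLattice c₁ ℓ₁) (L : DistributiveLattice c₂ ℓ₂)
  (finite : IsFinite D)
  (0L : DistributiveLattice.Carrier L) (0⊑ : ∀ x → _≤_ L 0L x)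
  (f : DistributiveLattice.Carrier D → DistributiveLattice.Carrier L)
  (hom : IsLatticeHom D L f) where

  private
    module D where
      open DistributiveLattice D public
      open LatticeOrder D public
      open FiniteLattice D finite public
  open DistributiveLattice L
  open LatticeOrder L
  open LatticeMorphisms.IsLatticeHomomorphism hom
  open D using (enum; index; enum-index; _⊑?_)

  f-mono : ∀ {x y} → x D.⊑ y → f x ⊑ f y
  f-mono {x} {y} x⊑y = trans (sym (∧-homo x y)) (⟦⟧-cong x⊑y)

  ⊑0⇒≈0 : ∀ {x} → x ⊑ 0L → x ≈ 0L
  ⊑0⇒≈0 x⊑0 = ⊑-antisym x⊑0 (0⊑ _)

  module KernelFromConsonantRange (consonant : RangeConsonant L 0L D f) where
    open ConsonantFamily L 0L (f ∘ enum) (λ i j → consonant (enum i) (enum j))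

    factor : D.Carrier → Fin D.size → Carrier
    factor p j with p ⊑? enum j
    ... | yes _ = f p
    ... | no _  = δ (index p) j

    e : (p : D.Carrier) → IsJoinIrreducible D p → Carrier
    e p _ = ⋀ (f p) (factor p)

    f⊑f-lowerCover∨factor : ∀ {p q} → IsJoinIrreducible D p → IsLowerCover D q p →
                            ∀ j → f p ⊑ f q ∨ factor p j
    f⊑f-lowerCover∨factor {p} {q} jp cover j with p ⊑? enum j
    ... | yes _    = y⊑x∨y _ _
    ... | no p⋢xⱼ = begin
      f p                       ≤⟨ ∧-greatest (⊑-respˡ-≈ (⟦⟧-cong (enum-index p)) (δ-cover (index p) j))
                                              (y⊑x∨y _ _) ⟩
      (d ∨ f xⱼ) ∧ (d ∨ f p)   ≈⟨ ∨-distribˡ-∧ d (f xⱼ) (f p) ⟨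
      d ∨ (f xⱼ ∧ f p)         ≈⟨ ∨-congˡ (∧-homo xⱼ p) ⟨
      d ∨ f (xⱼ D.∧ p)         ≤⟨ ∨-monotonic ⊑-refl (f-mono (D.⊏⇒⊑lowerCover jp cover xⱼ∧p⊏p)) ⟩
      d ∨ f q                   ≈⟨ ∨-comm d (f q) ⟩
      f q ∨ d                   ∎
      where
      open ⊑-Reasoning
      xⱼ : D.Carrier
      xⱼ = enum j
      d : Carrier
      d = δ (index p) j
      xⱼ∧p⊏p : xⱼ D.∧ p D.⊏ p
      xⱼ∧p⊏p = D.x∧y⊑y xⱼ p , λ xⱼ∧p≈p → p⋢xⱼ (D.⊑-respˡ-≈ xⱼ∧p≈p (D.x∧y⊑x xⱼ p))

    factor⊑δ : ∀ {p j} → ¬ p D.⊑ enum j → factor p j ⊑ δ (index p) j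
    factor⊑δ {p} {j} p⋢xⱼ with p ⊑? enum j
    ... | yes p⊑xⱼ = ⊥-elim (p⋢xⱼ p⊑xⱼ)
    ... | no _      = ⊑-refl

    isConsonanceKernel : IsConsonanceKernel L 0L D f e
    isConsonanceKernel = cover-eq , disjoint
      where
      cover-eq : ∀ p jp q → IsLowerCover D q p → f p ≈ f q ∨ e p jp
      cover-eq p jp q cover = ⊑-antisym
        (∨-⋀-greatest (y⊑x∨y _ _) (f⊑f-lowerCover∨factor jp cover))
        (∨-least (f-mono (proj₁ cover)) (⋀-lower-base (f p) (factor p)))

      disjoint : ∀ p jp q jq → Incomparable D p q → e p jp ∧ e q jq ≈ 0L
      disjoint p jp q jq (p⋢q , q⋢p) = ⊑0⇒≈0 (begin
        e p jp ∧ e q jq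
          ≤⟨ ∧-monotonic (⋀-lower (f p) (factor p) (index q)) (⋀-lower (f q) (factor q) (index p)) ⟩
        factor p (index q) ∧ factor q (index p)
          ≤⟨ ∧-monotonic (factor⊑δ (p⋢q ∘ D.⊑-respʳ-≈ (enum-index q)))
                         (factor⊑δ (q⋢p ∘ D.⊑-respʳ-≈ (enum-index p))) ⟩
        δ (index p) (index q) ∧ δ (index q) (index p)
          ≈⟨ δ-disjoint (p⋢q ∘ D.⊑-reflexive ∘ D.index≡⇒≈) ⟩
        0L ∎)
        where open ⊑-Reasoning

  module ConsonantRangeFromKernel (e : (p : D.Carrier) → IsJoinIrreducible D p → Carrier)
                                  (isKernel : IsConsonanceKernel L 0L D f e) where
    open D using (Reducible; bottom; join; reducible⊎joinIrreducible)

    -- e may depend on the irreducibility proof, so the classification is an argument: the cover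
    -- proof below has to use the very proof that u uses.
    kernelPart : (x y p : D.Carrier) → Reducible p ⊎ IsJoinIrreducible D p → Carrier
    kernelPart x y p (inj₁ _)  = 0L
    kernelPart x y p (inj₂ jp) with p ⊑? x | p ⊑? y
    ... | yes _ | no _ = e p jp
    ... | _     | _    = 0L

    parts : D.Carrier → D.Carrier → Fin D.size → Carrier
    parts x y j = kernelPart x y (enum j) (reducible⊎joinIrreducible (enum j))

    u : D.Carrier → D.Carrier → Carrier
    u x y = ⋁ 0L (parts x y)

    kernelPart-cases : ∀ x y p r → kernelPart x y p r ⊑ 0L ⊎
      Σ (IsJoinIrreducible D p) λ jp → p D.⊑ x × ¬ p D.⊑ y × kernelPart x y p r ⊑ e p jp
    kernelPart-cases x y p (inj₁ _) = inj₁ ⊑-refl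
    kernelPart-cases x y p (inj₂ jp) with p ⊑? x | p ⊑? y
    ... | yes p⊑x | no p⋢y = inj₂ (jp , p⊑x , p⋢y , ⊑-refl)
    ... | yes _   | yes _  = inj₁ ⊑-refl
    ... | no _    | _      = inj₁ ⊑-refl

    e⊑kernelPart : ∀ {x y p} jp → p D.⊑ x → ¬ p D.⊑ y → e p jp ⊑ kernelPart x y p (inj₂ jp)
    e⊑kernelPart {x} {y} {p} jp p⊑x p⋢y with p ⊑? x | p ⊑? y
    ... | yes _   | no _    = ⊑-refl
    ... | _       | yes p⊑y = ⊥-elim (p⋢y p⊑y)
    ... | no p⋢x  | no _    = ⊥-elim (p⋢x p⊑x)

    kernelPart-disjoint : ∀ x y p q r s → kernelPart x y p r ∧ kernelPart y x q s ⊑ 0L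
    kernelPart-disjoint x y p q r s with kernelPart-cases x y p r | kernelPart-cases y x q s
    ... | inj₁ t⊑0 | _        = ⊑-trans (x∧y⊑x _ _) t⊑0
    ... | inj₂ _   | inj₁ t⊑0 = ⊑-trans (x∧y⊑y _ _) t⊑0
    ... | inj₂ (jp , p⊑x , p⋢y , t⊑e) | inj₂ (jq , q⊑y , q⋢x , t′⊑e) =
      ⊑-trans (∧-monotonic t⊑e t′⊑e) (⊑-reflexive (proj₂ isKernel p jp q jq
        ((λ p⊑q → p⋢y (D.⊑-trans p⊑q q⊑y)) , (λ q⊑p → q⋢x (D.⊑-trans q⊑p p⊑x)))))

    u-disjoint : ∀ x y → u x y ∧ u y x ≈ 0L
    u-disjoint x y = ⊑0⇒≈0 (⊑-respˡ-≈ (∧-comm _ _)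
      (∧-⋁-least {g = parts x y} (x∧y⊑y _ _) λ j → ⊑-respˡ-≈ (∧-comm _ _)
        (∧-⋁-least {g = parts y x} (x∧y⊑y _ _) λ k → kernelPart-disjoint x y (enum j) (enum k)
          (reducible⊎joinIrreducible (enum j)) (reducible⊎joinIrreducible (enum k)))))

    module _ (x y : D.Carrier) where
      Covered : D.Carrier → Set (ℓ₁ ⊔ ℓ₂)
      Covered z = z D.⊑ x → f z ⊑ f y ∨ u x y

      covered-enum : ∀ j → WfRec D._⊏_ Covered (enum j) →
                     (r : Reducible (enum j) ⊎ IsJoinIrreducible D (enum j)) →
                     kernelPart x y (enum j) r ⊑ u x y → Covered (enum j)
      covered-enum j rec r _ xⱼ⊑x with enum j ⊑? y
      ... | yes xⱼ⊑y = ⊑-trans (f-mono xⱼ⊑y) (x⊑x∨y _ _)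
      covered-enum j rec (inj₁ (bottom xⱼ⊑all)) _ xⱼ⊑x | no xⱼ⋢y = ⊥-elim (xⱼ⋢y (xⱼ⊑all y))
      covered-enum j rec (inj₁ (join a b a⊏xⱼ b⊏xⱼ xⱼ≈a∨b)) _ xⱼ⊑x | no _ =
        ⊑-respˡ-≈ (sym (trans (⟦⟧-cong xⱼ≈a∨b) (∨-homo a b)))
          (∨-least (rec a⊏xⱼ (D.⊑-trans (proj₁ a⊏xⱼ) xⱼ⊑x))
                   (rec b⊏xⱼ (D.⊑-trans (proj₁ b⊏xⱼ) xⱼ⊑x)))
      covered-enum j rec (inj₂ jp) e⊑u xⱼ⊑x | no xⱼ⋢y =
        ⊑-respˡ-≈ (sym (proj₁ isKernel (enum j) jp q q≺xⱼ))
          (∨-least (rec q⊏xⱼ (D.⊑-trans (proj₁ q⊏xⱼ) xⱼ⊑x))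
                   (⊑-trans (⊑-trans (e⊑kernelPart jp xⱼ⊑x xⱼ⋢y) e⊑u) (y⊑x∨y _ _)))
        where
        q : D.Carrier
        q = proj₁ (D.lowerCover jp)
        q≺xⱼ : IsLowerCover D q (enum j)
        q≺xⱼ = proj₂ (D.lowerCover jp)
        q⊏xⱼ : q D.⊏ enum j
        q⊏xⱼ = proj₁ q≺xⱼ , proj₁ (proj₂ q≺xⱼ)

      covered : ∀ z → Covered z
      covered = All.wfRec D.⊏-wellFounded _ Covered λ z rec z⊑x →
        ⊑-respˡ-≈ (⟦⟧-cong (enum-index z))
          (covered-enum (index z) (rec ∘ D.⊏-respʳ-≈ (enum-index z))
            (reducible⊎joinIrreducible (enum (index z))) (⋁-upper 0L (parts x y) (index z))
            (D.⊑-respˡ-≈ (D.sym (enum-index z)) z⊑x))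

    rangeConsonant : RangeConsonant L 0L D f
    rangeConsonant x y = u x y , u y x ,
      ⊑-respʳ-≈ (∨-comm _ _) (covered x y x D.⊑-refl) , covered y x y D.⊑-refl , u-disjoint x y

lemma3p3 : {c₁ ℓ₁ c₂ ℓ₂ : Level}
    (D : DistributiveLattice c₁ ℓ₁) (L : DistributiveLattice c₂ ℓ₂) →
    IsFinite D →
    (0L : DistributiveLattice.Carrier L) → (∀ x → _≤_ L 0L x) →
    (f : DistributiveLattice.Carrier D → DistributiveLattice.Carrier L) →
    IsLatticeHom D L f →
    HasConsonanceKernel L 0L D f ⇔ RangeConsonant L 0L D f
lemma3p3 D L finite 0L 0⊑ f hom = mk⇔
  (λ (e , isKernel) → ConsonantRangeFromKernel.rangeConsonant D L finite 0L 0⊑ f hom e isKernel)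
  (λ consonant → KernelFromConsonantRange.e D L finite 0L 0⊑ f hom consonant ,
                 KernelFromConsonantRange.isConsonanceKernel D L finite 0L 0⊑ f hom consonant)
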